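{- For every positive integer $t$ there exists a constant $c=c(t)<1/4$ such that for all sufficiently large $n$ the following holds: if an $n$-vertex graph $G$ contains a triangle but contains neither $H(t)$ nor $Q(t)$ as a subgraph, then $G$ has a vertex of degree at most $cn$.
   Context: $H(t)$ is the graph on pairwise disjoint vertex sets $A_1,B_1,A_2,B_2$, each of size $t$, together with three further vertices $x,y,z$, whose edges are: all pairs between $A_1$ and $B_1$, all pairs between $A_2$ and $B_2$, the triangle $xyz$, all pairs between $x$ and $A_1$, all pairs between $y$ and $B_1$, and all pairs between $z$ and $A_2$ (so $x,y$ extend one $K_{t,t}$ to a $K_{t+1,t+1}$ and $z$ extends the other $K_{t,t}$ to a $K_{t,t+1}$). $Q(t)$ is the graph on pairwise disjoint independent sets $U_1,U_2,U_3,U_4$, each of size $t$, together with a triangle $v_1v_2v_3$, where for each $i\le 3$ the vertex $v_i$ and every vertex of $U_4$ are joined to every vertex of $U_i$ (and there are no other edges). -}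

module Defs where

open import Data.Nat using (ℕ)
open import Data.Fin using (Fin; zero; suc)
open import Data.Fin.Subset using (Subset; ∣_∣)
open import Data.Vec using (tabulate)
open import Data.Bool using (Bool)
open import Data.Product using (Σ; _×_; ∃-syntax)
open import Data.Sum using (_⊎_)
open import Function.Definitions using (Injective)
open import Relation.Binary.PropositionalEquality using (_≡_)
open import Relation.Nullary using (¬_; Dec)
open import Relation.Nullary.Decidable using (⌊_⌋)

record Graph (n : ℕ) : Set₁ where
  field
    Adj      : Fin n → Fin n → Set
    adj?     : ∀ u v → Dec (Adj u v)
    sym      : ∀ {u v} → Adj u v → Adj v u
    irrefl   : ∀ {u} → ¬ Adj u u
open Graph public

degree : ∀ {n} → Graph n → Fin n → ℕ
degree G v = ∣ tabulate (λ u → ⌊ adj? G v u ⌋) ∣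

Contains : ∀ {n} → Graph n → (V : Set) → (V → V → Set) → Set
Contains {n} G V E =
  Σ (V → Fin n) λ f → Injective _≡_ _≡_ f × (∀ {a b} → E a b → Adj G (f a) (f b))

HasTriangle : ∀ {n} → Graph n → Set
HasTriangle {n} G = ∃[ a ] ∃[ b ] ∃[ c ] (Adj G a b × Adj G b c × Adj G a c)

data HV (t : ℕ) : Set where
  a₁ b₁ a₂ b₂ : Fin t → HV t
  x y z : HV t

data HE₀ (t : ℕ) : HV t → HV t → Set where
  a₁b₁ : ∀ i j → HE₀ t (a₁ i) (b₁ j)
  a₂b₂ : ∀ i j → HE₀ t (a₂ i) (b₂ j)
  xy   : HE₀ t x y
  yz   : HE₀ t y z
  xz   : HE₀ t x z
  xa₁  : ∀ i → HE₀ t x (a₁ i)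
  yb₁  : ∀ i → HE₀ t y (b₁ i)
  za₂  : ∀ i → HE₀ t z (a₂ i)

HE : (t : ℕ) → HV t → HV t → Set
HE t u v = HE₀ t u v ⊎ HE₀ t v u

data QV (t : ℕ) : Set where
  u : Fin 4 → Fin t → QV t     -- u j i : i-th vertex of U_{j+1}
  v : Fin 3 → QV t             -- v j   : v_{j+1}

inj₃ : Fin 3 → Fin 4
inj₃ zero = zero
inj₃ (suc zero) = suc zero
inj₃ (suc (suc zero)) = suc (suc zero)

data QE₀ (t : ℕ) : QV t → QV t → Set where
  vv   : ∀ {j k} → j Data.Fin.< k → QE₀ t (v j) (v k)
  vU   : ∀ j i → QE₀ t (v j) (u (inj₃ j) i)
  U₄U  : ∀ j i k → QE₀ t (u (suc (suc (suc zero))) k) (u (inj₃ j) i)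

QE : (t : ℕ) → QV t → QV t → Set
QE t a b = QE₀ t a b ⊎ QE₀ t b a

-- Suppose every vertex has degree above 6n/25 = 0.24n, and call w rich for p
-- when at least n/1000 neighbours of w are neighbours of p.  Greedily choosing
-- hubs with many common neighbours embeds H(t) as soon as, for a triangle pqr,
-- n/1000 neighbours of q are rich for p, and embeds Q(t) as soon as n/1000
-- vertices are rich for each of p, q and r.  So in an H(t)- and Q(t)-free graph
-- these sets are small.  Double counting paths of length two then shows that
-- more than 0.23n vertices are rich for p, while fewer than n/239 neighbours of
-- p lie on a triangle through p.  Summing a pointwise inequality between the
-- indicators of N(p), N(q), N(r) and of the rich sets of p, q, r over all
-- vertices yields 2.13n ≤ 2.094n, which is absurd.
module Submission where

module Counting where

  open import Data.Bool using (Bool; true; false; T; not; _∧_; _∨_; if_then_else_)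
  open import Data.Bool.Properties using (T-∧; T-∨)
  open import Data.Sum using ([_,_]; inj₁; inj₂)
  open import Function.Bundles using (Equivalence)
  open import Data.Fin using (Fin; zero; suc; _≟_)
  open import Data.List using (List; []; _∷_; map; length)
  open import Data.Nat.ListAction using () renaming (sum to sumᴸ)
  open import Data.List.Relation.Unary.All using (All; []; _∷_)
  open import Data.Nat using (ℕ; zero; suc; _+_; _*_; _≤_; z≤n; s≤s; NonZero; >-nonZero)
  open import Data.Nat.Properties hiding (_≟_)
  open import Data.Product using (∃; _,_; proj₁; proj₂)
  open import Data.Unit using (tt)
  open import Relation.Binary.PropositionalEquality hiding ([_])
  open import Relation.Nullary using (¬_)
  open import Relation.Nullary.Decidable using (does; yes; no)
  open import Data.Empty using (⊥-elim)
  open import Algebra.Properties.Semiring.Sum +-*-semiring public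
    using (sum; sum-syntax; sum-cong-≗; ∑-distrib-+; ∑-comm; *-distribˡ-sum; *-distribʳ-sum)

  VSet : ℕ → Set
  VSet n = Fin n → Bool

  module _ {n : ℕ} where

    infix 4 _∈_ _∉_ _⊆_
    infixr 7 _∩_
    infixr 6 _∪_

    _∈_ : Fin n → VSet n → Set
    i ∈ P = T (P i)

    _∉_ : Fin n → VSet n → Set
    i ∉ P = ¬ i ∈ P

    _⊆_ : VSet n → VSet n → Set
    P ⊆ Q = ∀ {i} → i ∈ P → i ∈ Q

    ∅ : VSet n
    ∅ _ = false

    all : VSet n
    all _ = true

    ∁ : VSet n → VSet n
    ∁ P i = not (P i)

    _∩_ _∪_ : VSet n → VSet n → VSet n
    (P ∩ Q) i = P i ∧ Q i
    (P ∪ Q) i = P i ∨ Q i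

    ⁅_⁆ : Fin n → VSet n
    ⁅ s ⁆ i = does (i ≟ s)

  ∈⁅⁆⇒≡ : ∀ {n} {i s : Fin n} → i ∈ ⁅ s ⁆ → i ≡ s
  ∈⁅⁆⇒≡ {i = i} {s} i∈⁅s⁆ with i ≟ s
  ... | yes i≡s = i≡s

  module _ {n : ℕ} (P Q : VSet n) where

    ∩⁺ : ∀ {i} → i ∈ P → i ∈ Q → i ∈ P ∩ Q
    ∩⁺ i∈P i∈Q = Equivalence.from T-∧ (i∈P , i∈Q)

    ∩⊆ˡ : P ∩ Q ⊆ P
    ∩⊆ˡ i∈P∩Q = proj₁ (Equivalence.to T-∧ i∈P∩Q)

    ∩⊆ʳ : P ∩ Q ⊆ Q
    ∩⊆ʳ i∈P∩Q = proj₂ (Equivalence.to T-∧ i∈P∩Q)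

    ∪⊇ˡ : P ⊆ P ∪ Q
    ∪⊇ˡ i∈P = Equivalence.from T-∨ (inj₁ i∈P)

    ∪⊇ʳ : Q ⊆ P ∪ Q
    ∪⊇ʳ i∈Q = Equivalence.from T-∨ (inj₂ i∈Q)

    ∉-∪ : ∀ {i} → i ∉ P → i ∉ Q → i ∉ P ∪ Q
    ∉-∪ i∉P i∉Q i∈P∪Q = [ i∉P , i∉Q ] (Equivalence.to T-∨ i∈P∪Q)

  ∈∁⇒∉ : ∀ {n} {P : VSet n} {i : Fin n} → i ∈ ∁ P → i ∉ P
  ∈∁⇒∉ {P = P} {i} with P i
  ... | false = λ _ ()

  ∈⁅⁆ : ∀ {n} (s : Fin n) → s ∈ ⁅ s ⁆
  ∈⁅⁆ s with s ≟ s
  ... | yes _ = tt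
  ... | no s≢s = s≢s refl

  ∉⁅⁆ : ∀ {n} {i s : Fin n} → i ≢ s → i ∉ ⁅ s ⁆
  ∉⁅⁆ i≢s i∈⁅s⁆ = i≢s (∈⁅⁆⇒≡ i∈⁅s⁆)

  ⟦_⟧ : Bool → ℕ
  ⟦ true ⟧ = 1
  ⟦ false ⟧ = 0

  ∑-mono : ∀ {n} {f g : Fin n → ℕ} → (∀ i → f i ≤ g i) → sum f ≤ sum g
  ∑-mono {zero} f≤g = z≤n
  ∑-mono {suc n} f≤g = +-mono-≤ (f≤g zero) (∑-mono (λ i → f≤g (suc i)))

  ∑-const : ∀ n c → ∑[ i < n ] c ≡ n * c
  ∑-const zero c = refl
  ∑-const (suc n) c = cong (c +_) (∑-const n c)

  ∑-+-* : ∀ {n} (f : Fin n → ℕ) k (g : Fin n → ℕ) → ∑[ i < n ] (f i + k * g i) ≡ sum f + k * sum g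
  ∑-+-* f k g = trans (∑-distrib-+ f (λ i → k * g i)) (cong (sum f +_) (sym (*-distribˡ-sum k g)))

  ∃-≥-average : ∀ {n} .{{_ : NonZero n}} (f : Fin n → ℕ) → ∃ λ i → sum f ≤ n * f i
  ∃-≥-average {suc zero} f = zero , ≤-refl
  ∃-≥-average {suc (suc n)} f with ∃-≥-average (λ i → f (suc i))
  ... | i , ∑≤ with f zero ≤? f (suc i)
  ...   | yes f₀≤fᵢ = suc i , +-mono-≤ f₀≤fᵢ ∑≤
  ...   | no f₀≰fᵢ = zero , +-monoʳ-≤ (f zero) (≤-trans ∑≤ (*-monoʳ-≤ (suc n) (<⇒≤ (≰⇒> f₀≰fᵢ))))

  #true : List Bool → ℕ
  #true bs = sumᴸ (map ⟦_⟧ bs)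

  count : ∀ {n} → VSet n → ℕ
  count {n} P = ∑[ i < n ] ⟦ P i ⟧

  count-∅ : ∀ {n} → count (∅ {n}) ≡ 0
  count-∅ {n} = trans (∑-const n 0) (*-zeroʳ n)

  count-⁅⁆ : ∀ {n} (s : Fin n) → count ⁅ s ⁆ ≡ 1
  count-⁅⁆ {suc n} zero = cong suc (count-∅ {n})
  count-⁅⁆ {suc n} (suc s) = count-⁅⁆ s

  module _ {n : ℕ} where

    count-cong : {P Q : VSet n} → (∀ i → P i ≡ Q i) → count P ≡ count Q
    count-cong P≗Q = sum-cong-≗ (λ i → cong ⟦_⟧ (P≗Q i))

    count-all : count (all {n}) ≡ n
    count-all = trans (∑-const n 1) (*-identityʳ n)

    count-mono : {P Q : VSet n} → P ⊆ Q → count P ≤ count Q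
    count-mono {P} {Q} P⊆Q = ∑-mono (λ i → ⟦⟧-mono (P i) (Q i) P⊆Q)
      where
      ⟦⟧-mono : ∀ a b → (T a → T b) → ⟦ a ⟧ ≤ ⟦ b ⟧
      ⟦⟧-mono false b _ = z≤n
      ⟦⟧-mono true true _ = ≤-refl
      ⟦⟧-mono true false a⇒b = ⊥-elim (a⇒b tt)

    count≤n : (P : VSet n) → count P ≤ n
    count≤n P = ≤-trans (count-mono (λ _ → tt)) (≤-reflexive count-all)

    count-split : (P Q : VSet n) → count P ≡ count (P ∩ Q) + count (P ∩ ∁ Q)
    count-split P Q = trans (sum-cong-≗ (λ i → ⟦⟧-split (P i) (Q i)))
                            (∑-distrib-+ (λ i → ⟦ P i ∧ Q i ⟧) (λ i → ⟦ P i ∧ not (Q i) ⟧))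
      where
      ⟦⟧-split : ∀ a b → ⟦ a ⟧ ≡ ⟦ a ∧ b ⟧ + ⟦ a ∧ not b ⟧
      ⟦⟧-split false b = refl
      ⟦⟧-split true false = refl
      ⟦⟧-split true true = refl

    count-∪ : (P Q : VSet n) → count (P ∪ Q) ≤ count P + count Q
    count-∪ P Q = ≤-trans (∑-mono (λ i → ⟦⟧-∨ (P i) (Q i)))
                          (≤-reflexive (∑-distrib-+ (λ i → ⟦ P i ⟧) (λ i → ⟦ Q i ⟧)))
      where
      ⟦⟧-∨ : ∀ a b → ⟦ a ∨ b ⟧ ≤ ⟦ a ⟧ + ⟦ b ⟧
      ⟦⟧-∨ false b = ≤-refl
      ⟦⟧-∨ true b = s≤s z≤n

    count-∪⁅⁆ : (P : VSet n) (s : Fin n) → count (P ∪ ⁅ s ⁆) ≤ suc (count P)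
    count-∪⁅⁆ P s = ≤-trans (count-∪ P ⁅ s ⁆)
                            (≤-reflexive (trans (cong (count P +_) (count-⁅⁆ s)) (+-comm (count P) 1)))

    count-∖ : (P F : VSet n) → count P ≤ count (P ∩ ∁ F) + count F
    count-∖ P F = begin
      count P                           ≡⟨ count-split P F ⟩
      count (P ∩ F) + count (P ∩ ∁ F)   ≤⟨ +-monoˡ-≤ (count (P ∩ ∁ F)) (count-mono {P = P ∩ F} (∩⊆ʳ P F)) ⟩
      count F + count (P ∩ ∁ F)         ≡⟨ +-comm (count F) _ ⟩
      count (P ∩ ∁ F) + count F         ∎
      where open ≤-Reasoning

    ∈⇒count-pos : {P : VSet n} {i : Fin n} → i ∈ P → 1 ≤ count P
    ∈⇒count-pos {P} {i} i∈P = ≤-trans (≤-reflexive (sym (count-⁅⁆ i))) (count-mono ⁅i⁆⊆P)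
      where
      ⁅i⁆⊆P : ⁅ i ⁆ ⊆ P
      ⁅i⁆⊆P {j} j∈⁅i⁆ = subst (_∈ P) (sym (∈⁅⁆⇒≡ j∈⁅i⁆)) i∈P

    count-pos⇒∈ : (P : VSet n) → 1 ≤ count P → ∃ (_∈ P)
    count-pos⇒∈ P 1≤∣P∣ = i , positive (P i) (≤-trans 1≤∣P∣ ∣P∣≤n⟦Pi⟧)
      where
      instance
        n≢0 : NonZero n
        n≢0 = >-nonZero (≤-trans 1≤∣P∣ (count≤n P))
      i = proj₁ (∃-≥-average (λ i → ⟦ P i ⟧))
      ∣P∣≤n⟦Pi⟧ = proj₂ (∃-≥-average (λ i → ⟦ P i ⟧))
      positive : ∀ b → 1 ≤ n * ⟦ b ⟧ → T b
      positive true _ = tt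
      positive false 1≤n*0 with () ← ≤-trans 1≤n*0 (≤-reflexive (*-zeroʳ n))

    masked-count : ∀ b (P : VSet n) → (if b then count P else 0) ≡ count (λ i → b ∧ P i)
    masked-count true P = refl
    masked-count false P = sym (count-∅ {n})

    ∑∈-syntax : VSet n → (Fin n → ℕ) → ℕ
    ∑∈-syntax A f = ∑[ i < n ] (if A i then f i else 0)

    syntax ∑∈-syntax A (λ i → x) = ∑[ i ∈ A ] x

    ∑∈-≤ : (A : VSet n) (c : ℕ) {f : Fin n → ℕ} {k : ℕ} →
           (∀ {i} → i ∈ A → c * f i ≤ k) → c * ∑[ i ∈ A ] f i ≤ count A * k
    ∑∈-≤ A c {f} {k} bound = begin
      c * ∑[ i ∈ A ] f i                         ≡⟨ *-distribˡ-sum c (λ i → if A i then f i else 0) ⟩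
      ∑[ i < n ] (c * (if A i then f i else 0))  ≤⟨ ∑-mono (λ i → masked (A i) bound) ⟩
      ∑[ i < n ] (⟦ A i ⟧ * k)                   ≡⟨ *-distribʳ-sum k (λ i → ⟦ A i ⟧) ⟨
      count A * k                                ∎
      where
      open ≤-Reasoning
      masked : ∀ b {x} → (T b → c * x ≤ k) → c * (if b then x else 0) ≤ ⟦ b ⟧ * k
      masked true cx≤k = ≤-trans (cx≤k tt) (≤-reflexive (sym (*-identityˡ k)))
      masked false _ = ≤-reflexive (*-zeroʳ c)

    ∑∈-≥ : (A : VSet n) (c : ℕ) {f : Fin n → ℕ} {k : ℕ} →
           (∀ {i} → i ∈ A → k ≤ c * f i) → count A * k ≤ c * ∑[ i ∈ A ] f i
    ∑∈-≥ A c {f} {k} bound = begin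
      count A * k                                ≡⟨ *-distribʳ-sum k (λ i → ⟦ A i ⟧) ⟩
      ∑[ i < n ] (⟦ A i ⟧ * k)                   ≤⟨ ∑-mono (λ i → masked (A i) bound) ⟩
      ∑[ i < n ] (c * (if A i then f i else 0))  ≡⟨ *-distribˡ-sum c (λ i → if A i then f i else 0) ⟨
      c * ∑[ i ∈ A ] f i                         ∎
      where
      open ≤-Reasoning
      masked : ∀ b {x} → (T b → k ≤ c * x) → ⟦ b ⟧ * k ≤ c * (if b then x else 0)
      masked true k≤cx = ≤-trans (≤-reflexive (*-identityˡ k)) (k≤cx tt)
      masked false _ = z≤n

    ∑-partition : (A : VSet n) (f : Fin n → ℕ) →
                  ∑[ i < n ] f i ≡ ∑[ i ∈ A ] f i + ∑[ i ∈ ∁ A ] f i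
    ∑-partition A f = trans (sum-cong-≗ (λ i → split (A i)))
                            (∑-distrib-+ (λ i → if A i then f i else 0) (λ i → if not (A i) then f i else 0))
      where
      split : ∀ b {x} → x ≡ (if b then x else 0) + (if not b then x else 0)
      split true = sym (+-identityʳ _)
      split false = refl

    hits : List (VSet n) → Fin n → ℕ
    hits Ps i = #true (map (λ P → P i) Ps)

    counts : List (VSet n) → ℕ
    counts Ps = sumᴸ (map count Ps)

    ∑-hits : (Ps : List (VSet n)) → ∑[ i < n ] hits Ps i ≡ counts Ps
    ∑-hits [] = count-∅ {n}
    ∑-hits (P ∷ Ps) = trans (∑-distrib-+ (λ i → ⟦ P i ⟧) (hits Ps)) (cong (count P +_) (∑-hits Ps))

    counts-≤ : (Ps : List (VSet n)) (c k : ℕ) →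
               All (λ P → c * count P ≤ k) Ps → c * counts Ps ≤ length Ps * k
    counts-≤ [] c k [] = ≤-reflexive (*-zeroʳ c)
    counts-≤ (P ∷ Ps) c k (cP≤k ∷ cPs≤k) =
      ≤-trans (≤-reflexive (*-distribˡ-+ c (count P) (counts Ps)))
              (+-mono-≤ cP≤k (counts-≤ Ps c k cPs≤k))

    counts-≥ : (Ps : List (VSet n)) (c k : ℕ) →
               All (λ P → k ≤ c * count P) Ps → length Ps * k ≤ c * counts Ps
    counts-≥ [] c k [] = z≤n
    counts-≥ (P ∷ Ps) c k (k≤cP ∷ k≤cPs) =
      ≤-trans (+-mono-≤ k≤cP (counts-≥ Ps c k k≤cPs))
              (≤-reflexive (sym (*-distribˡ-+ c (count P) (counts Ps))))

module Neighbourhoods where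

  open Counting
  open import Defs using (Graph; Adj; adj?; degree)
  import Defs
  open import Data.Bool using (true; false; not; _∧_)
  open import Data.Bool.Properties using (∧-comm; ∧-assoc; ∧-identityʳ)
  open import Data.Fin using (Fin; zero; suc)
  open import Data.Fin.Subset using (∣_∣)
  open import Data.Nat using (ℕ; zero; suc; _+_; _≤_; _≤ᵇ_)
  open import Data.Nat.Properties using (≤-trans; ≤-reflexive)
  open import Data.Vec using (tabulate)
  open import Relation.Binary.PropositionalEquality
  open import Relation.Nullary using (yes; no)
  open import Relation.Nullary.Decidable using (⌊_⌋; toWitness; fromWitness)
  open import Data.Empty using (⊥-elim)
  open import Function using (_∘_)

  ∣tabulate∣≡count : ∀ {n} (P : VSet n) → ∣ tabulate P ∣ ≡ count P
  ∣tabulate∣≡count {zero} P = refl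
  ∣tabulate∣≡count {suc n} P with P zero
  ... | true = cong suc (∣tabulate∣≡count (λ i → P (suc i)))
  ... | false = ∣tabulate∣≡count (λ i → P (suc i))

  module _ {n : ℕ} (G : Graph n) where

    N : Fin n → VSet n
    N v w = ⌊ adj? G v w ⌋

    ∈N⇒Adj : ∀ {v w} → w ∈ N v → Adj G v w
    ∈N⇒Adj = toWitness

    Adj⇒∈N : ∀ {v w} → Adj G v w → w ∈ N v
    Adj⇒∈N = fromWitness

    N-sym : ∀ v w → N v w ≡ N w v
    N-sym v w with adj? G v w | adj? G w v
    ... | yes _ | yes _ = refl
    ... | no _ | no _ = refl
    ... | yes vw | no ¬wv = ⊥-elim (¬wv (Defs.sym G vw))
    ... | no ¬vw | yes wv = ⊥-elim (¬vw (Defs.sym G wv))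

    ∈N-sym : ∀ {v w} → w ∈ N v → v ∈ N w
    ∈N-sym = Adj⇒∈N ∘ Defs.sym G ∘ ∈N⇒Adj

    degree≡count : ∀ v → degree G v ≡ count (N v)
    degree≡count v = ∣tabulate∣≡count (N v)

    degIn : VSet n → Fin n → ℕ
    degIn S w = count (N w ∩ S)

    degIn-all : ∀ w → count (N w) ≡ degIn all w
    degIn-all w = count-cong (λ v → sym (∧-identityʳ (N w v)))

    touches : VSet n → VSet n
    touches S w = 1 ≤ᵇ degIn S w

    degIn-∖ : (S F : VSet n) (w : Fin n) → degIn S w ≤ degIn (S ∩ ∁ F) w + count F
    degIn-∖ S F w = ≤-trans (count-∖ (N w ∩ S) F)
      (≤-reflexive (cong (_+ count F) (count-cong (λ v → ∧-assoc (N w v) (S v) (not (F v))))))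

    double-counting : (A B : VSet n) → ∑[ a ∈ A ] degIn B a ≡ ∑[ b ∈ B ] degIn A b
    double-counting A B = begin
      ∑[ a ∈ A ] degIn B a
        ≡⟨ sum-cong-≗ (λ a → masked-count (A a) (N a ∩ B)) ⟩
      ∑[ a < n ] ∑[ b < n ] ⟦ A a ∧ (N a b ∧ B b) ⟧
        ≡⟨ ∑-comm (λ a b → ⟦ A a ∧ (N a b ∧ B b) ⟧) ⟩
      ∑[ b < n ] ∑[ a < n ] ⟦ A a ∧ (N a b ∧ B b) ⟧
        ≡⟨ sum-cong-≗ (λ b → sum-cong-≗ (λ a → cong ⟦_⟧ (edge-sym a b))) ⟩
      ∑[ b < n ] ∑[ a < n ] ⟦ B b ∧ (N b a ∧ A a) ⟧
        ≡⟨ sum-cong-≗ (λ b → masked-count (B b) (N b ∩ A)) ⟨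
      ∑[ b ∈ B ] degIn A b
        ∎
      where
      open ≡-Reasoning
      edge-sym : ∀ a b → A a ∧ (N a b ∧ B b) ≡ B b ∧ (N b a ∧ A a)
      edge-sym a b = begin
        A a ∧ (N a b ∧ B b)  ≡⟨ ∧-comm (A a) _ ⟩
        (N a b ∧ B b) ∧ A a  ≡⟨ cong (λ e → (e ∧ B b) ∧ A a) (N-sym a b) ⟩
        (N b a ∧ B b) ∧ A a  ≡⟨ cong (_∧ A a) (∧-comm (N b a) (B b)) ⟩
        (B b ∧ N b a) ∧ A a  ≡⟨ ∧-assoc (B b) (N b a) (A a) ⟩
        B b ∧ (N b a ∧ A a)  ∎

module FreshInjections where

  open Counting
  open import Data.Fin using (Fin; zero; suc; splitAt; join)
  open import Data.Fin.Properties using (join-splitAt)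
  open import Data.Nat using (ℕ; zero; suc; _+_; _≤_; z≤n; s≤s)
  open import Data.Nat.Properties hiding (_≟_)
  open import Data.Product using (Σ; _,_; proj₁; proj₂)
  open import Data.Sum using (_⊎_; inj₁; inj₂; [_,_]; [_,_]′)
  open import Data.Empty using (⊥-elim)
  open import Function using (_∘_)
  open import Function.Definitions using (Injective)
  open import Function.Consequences.Propositional using (inverseʳ⇒injective; strictlyInverseʳ⇒inverseʳ)
  open import Relation.Binary.PropositionalEquality hiding ([_])

  retraction⇒injective : {A B : Set} (f : A → B) (g : B → A) →
                         (∀ a → g (f a) ≡ a) → Injective _≡_ _≡_ f
  retraction⇒injective f g g∘f≗id = inverseʳ⇒injective f (strictlyInverseʳ⇒inverseʳ {f⁻¹ = g} f g∘f≗id)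

  module _ {n : ℕ} where

    -- An injection of A into the vertices avoiding F, together with a set `used` ⊇ F ∪ image
    -- of at most |F| + m vertices; choosing later vertices outside `used` keeps them disjoint.
    record Fresh (A : Set) (m : ℕ) (F : VSet n) : Set where
      field
        ι           : A → Fin n
        ι-injective : Injective _≡_ _≡_ ι
        ι-fresh     : ∀ a → ι a ∉ F
        used        : VSet n
        F⊆used      : F ⊆ used
        ι∈used      : ∀ a → ι a ∈ used
        ∣used∣      : count used ≤ count F + m

    open Fresh public

    reindex : {A B : Set} {m : ℕ} {F : VSet n} (e : B → A) → Injective _≡_ _≡_ e →
              Fresh A m F → Fresh B m F
    reindex e e-injective g = record
      { ι = ι g ∘ e ; ι-injective = e-injective ∘ ι-injective g ; ι-fresh = ι-fresh g ∘ e
      ; used = used g ; F⊆used = F⊆used g ; ι∈used = ι∈used g ∘ e ; ∣used∣ = ∣used∣ g }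

    infixl 5 _⊎-fresh_

    _⊎-fresh_ : {A B : Set} {m k : ℕ} {F : VSet n} (g : Fresh A m F) →
                Fresh B k (used g) → Fresh (A ⊎ B) (m + k) F
    _⊎-fresh_ {m = m} {k} {F} g h = record
      { ι = [ ι g , ι h ]′
      ; ι-injective = injective
      ; ι-fresh = [ ι-fresh g , (λ b → ι-fresh h b ∘ F⊆used g) ]
      ; used = used h
      ; F⊆used = F⊆used h ∘ F⊆used g
      ; ι∈used = [ F⊆used h ∘ ι∈used g , ι∈used h ]
      ; ∣used∣ = ≤-trans (∣used∣ h) (≤-trans (+-monoˡ-≤ k (∣used∣ g)) (≤-reflexive (+-assoc (count F) m k)))
      }
      where
      apart : ∀ a b → ι g a ≢ ι h b
      apart a b ga≡hb = ι-fresh h b (subst (_∈ used g) ga≡hb (ι∈used g a))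
      injective : Injective _≡_ _≡_ [ ι g , ι h ]′
      injective {inj₁ a} {inj₁ a′} eq = cong inj₁ (ι-injective g eq)
      injective {inj₁ a} {inj₂ b} eq = ⊥-elim (apart a b eq)
      injective {inj₂ b} {inj₁ a} eq = ⊥-elim (apart a b (sym eq))
      injective {inj₂ b} {inj₂ b′} eq = cong inj₂ (ι-injective h eq)

    fresh-[] : {F : VSet n} → Fresh (Fin 0) 0 F
    fresh-[] {F} = record
      { ι = λ () ; ι-injective = λ { {()} } ; ι-fresh = λ () ; used = F ; F⊆used = λ i∈F → i∈F
      ; ι∈used = λ () ; ∣used∣ = ≤-reflexive (sym (+-identityʳ (count F))) }

    fresh-vertex : {F : VSet n} (s : Fin n) → s ∉ F → Fresh (Fin 1) 1 F
    fresh-vertex {F} s s∉F = record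
      { ι = λ _ → s ; ι-injective = λ { {zero} {zero} _ → refl } ; ι-fresh = λ _ → s∉F
      ; used = F ∪ ⁅ s ⁆ ; F⊆used = ∪⊇ˡ F ⁅ s ⁆ ; ι∈used = λ _ → ∪⊇ʳ F ⁅ s ⁆ (∈⁅⁆ s)
      ; ∣used∣ = ≤-trans (count-∪⁅⁆ F s) (≤-reflexive (+-comm 1 (count F))) }

    fresh-∷ : {m : ℕ} {F : VSet n} (s : Fin n) → s ∉ F →
              Fresh (Fin m) m (F ∪ ⁅ s ⁆) → Fresh (Fin (suc m)) (suc m) F
    fresh-∷ {m} s s∉F g = reindex (splitAt 1) (retraction⇒injective (splitAt 1) (join 1 m) (join-splitAt 1 m))
                                  (fresh-vertex s s∉F ⊎-fresh g)

    choose : ∀ m {W F : VSet n} → m + count F ≤ count W → Σ (Fresh (Fin m) m F) λ g → ∀ i → ι g i ∈ W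
    choose zero _ = fresh-[] , λ ()
    choose (suc m) {W} {F} m+F≤W =
      fresh-∷ s s∉F (proj₁ rest) , λ { zero → ∩⊆ˡ W (∁ F) s∈W∖F ; (suc i) → proj₂ rest i }
      where
      open ≤-Reasoning
      W∖F-nonempty : 1 ≤ count (W ∩ ∁ F)
      W∖F-nonempty = +-cancelʳ-≤ (count F) 1 _ (begin
        1 + count F                ≤⟨ +-monoˡ-≤ (count F) (s≤s z≤n) ⟩
        suc m + count F            ≤⟨ m+F≤W ⟩
        count W                    ≤⟨ count-∖ W F ⟩
        count (W ∩ ∁ F) + count F  ∎)
      s = proj₁ (count-pos⇒∈ (W ∩ ∁ F) W∖F-nonempty)
      s∈W∖F = proj₂ (count-pos⇒∈ (W ∩ ∁ F) W∖F-nonempty)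
      s∉F = ∈∁⇒∉ {P = F} (∩⊆ʳ W (∁ F) s∈W∖F)
      rest = choose m {W} {F ∪ ⁅ s ⁆} (begin
        m + count (F ∪ ⁅ s ⁆)  ≤⟨ +-monoʳ-≤ m (count-∪⁅⁆ F s) ⟩
        m + suc (count F)      ≡⟨ +-suc m (count F) ⟩
        suc m + count F        ≤⟨ m+F≤W ⟩
        count W                ∎)

module GreedyEmbedding where

  open Counting
  open Neighbourhoods
  open FreshInjections
  open import Defs using (Graph; Adj)
  import Defs
  open import Data.Bool using (true; false; T; if_then_else_)
  open import Data.Fin using (Fin; zero; suc)
  open import Data.Nat using (ℕ; zero; suc; _+_; _*_; _^_; _≤_; z≤n; s≤s; NonZero; >-nonZero)
  open import Data.Nat.Properties hiding (_≟_)
  open import Algebra.Properties.CommutativeSemigroup *-commutativeSemigroup using (x∙yz≈y∙xz)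
  open import Data.Product using (∃; _×_; _,_; proj₁; proj₂)
  open import Data.Sum using (_⊎_; inj₁; inj₂)
  open import Data.Unit using (tt)
  open import Function using (_∘_; id)
  open import Relation.Binary.PropositionalEquality hiding ([_])

  record CommonNeighbourhood {n : ℕ} (G : Graph n) (m : ℕ) (S W F : VSet n) (c : ℕ) : Set where
    field
      hubs     : Fresh (Fin m) m F
      hubs⊆S   : ∀ i → ι hubs i ∈ S
      common   : VSet n
      common⊆W : common ⊆ W
      ∣common∣ : c ≤ count common
      adjacent : ∀ {w} → w ∈ common → ∀ i → Adj G w (ι hubs i)

  open CommonNeighbourhood public

  record Biclique {n : ℕ} (G : Graph n) (t : ℕ) (S W F : VSet n) : Set where
    field
      vertices : Fresh (Fin t ⊎ Fin t) (t + t) F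
      left⊆S   : ∀ i → ι vertices (inj₁ i) ∈ S
      right⊆W  : ∀ j → ι vertices (inj₂ j) ∈ W
      complete : ∀ i j → Adj G (ι vertices (inj₂ j)) (ι vertices (inj₁ i))

  open Biclique public

  module _ {n : ℕ} (G : Graph n) (K : ℕ) .{{_ : NonZero K}} where

    popular-vertex : {S W : VSet n} → 1 ≤ count W → (∀ {w} → w ∈ W → n ≤ K * degIn G S w) →
                     ∃ λ s → s ∈ S × count W ≤ K * degIn G W s
    popular-vertex {S} {W} W-nonempty dense = s , select (S s) (*-cancelˡ-≤ n (begin
      n * count W                   ≡⟨ *-comm n (count W) ⟩
      count W * n                   ≤⟨ ∑∈-≥ W K dense ⟩
      K * ∑[ w ∈ W ] degIn G S w    ≡⟨ cong (K *_) (double-counting G W S) ⟩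
      K * ∑[ s ∈ S ] degIn G W s    ≤⟨ *-monoʳ-≤ K ∑≤n*fs ⟩
      K * (n * f s)                 ≡⟨ x∙yz≈y∙xz K n (f s) ⟩
      n * (K * f s)                 ∎))
      where
      open ≤-Reasoning
      instance
        n≢0 : NonZero n
        n≢0 = >-nonZero (≤-trans W-nonempty (count≤n W))
      f : Fin n → ℕ
      f s = if S s then degIn G W s else 0
      s = proj₁ (∃-≥-average f)
      ∑≤n*fs = proj₂ (∃-≥-average f)
      select : ∀ b {x} → count W ≤ K * (if b then x else 0) → T b × count W ≤ K * x
      select true W≤Kx = tt , W≤Kx
      select false W≤K*0 with () ← ≤-trans W-nonempty (≤-trans W≤K*0 (≤-reflexive (*-zeroʳ K)))

    -- Each hub is a popular vertex for the current candidates, so a 1/K fraction of them stays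
    -- common to all hubs; the margin K * B pays for the at most B vertices avoided on the way.
    greedy-hubs : ∀ m {S W F : VSet n} {B c : ℕ} → count F + m ≤ B → 1 ≤ c →
                  (∀ {w} → w ∈ W → n + K * B ≤ K * degIn G S w) → K ^ m * c ≤ count W →
                  CommonNeighbourhood G m S W F c
    greedy-hubs zero {W = W} {c = c} _ _ _ c≤W = record
      { hubs = fresh-[] ; hubs⊆S = λ () ; common = W ; common⊆W = id
      ; ∣common∣ = ≤-trans (≤-reflexive (sym (*-identityˡ c))) c≤W ; adjacent = λ _ () }
    greedy-hubs (suc m) {S} {W} {F} {B} {c} F+m≤B 1≤c dense K^m*c≤W = record
      { hubs = fresh-∷ s s∉F (hubs rest)
      ; hubs⊆S = λ { zero → ∩⊆ˡ S (∁ F) s∈S∖F ; (suc i) → hubs⊆S rest i }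
      ; common = common rest
      ; common⊆W = ∩⊆ʳ (N G s) W ∘ common⊆W rest
      ; ∣common∣ = ∣common∣ rest
      ; adjacent = λ { w∈common zero → Defs.sym G (∈N⇒Adj G (∩⊆ˡ (N G s) W (common⊆W rest w∈common)))
                     ; w∈common (suc i) → adjacent rest w∈common i }
      }
      where
      open ≤-Reasoning
      F≤B : count F ≤ B
      F≤B = ≤-trans (m≤m+n (count F) (suc m)) F+m≤B
      dense-outside-F : ∀ {w} → w ∈ W → n ≤ K * degIn G (S ∩ ∁ F) w
      dense-outside-F {w} w∈W = +-cancelʳ-≤ (K * B) n _ (begin
        n + K * B                                     ≤⟨ dense w∈W ⟩
        K * degIn G S w                               ≤⟨ *-monoʳ-≤ K (degIn-∖ G S F w) ⟩
        K * (degIn G (S ∩ ∁ F) w + count F)           ≡⟨ *-distribˡ-+ K _ (count F) ⟩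
        K * degIn G (S ∩ ∁ F) w + K * count F         ≤⟨ +-monoʳ-≤ (K * degIn G (S ∩ ∁ F) w) (*-monoʳ-≤ K F≤B) ⟩
        K * degIn G (S ∩ ∁ F) w + K * B               ∎)
      W-nonempty : 1 ≤ count W
      W-nonempty = ≤-trans (*-mono-≤ (m^n>0 K (suc m)) 1≤c) K^m*c≤W
      popular = popular-vertex W-nonempty dense-outside-F
      s = proj₁ popular
      s∈S∖F = proj₁ (proj₂ popular)
      s∉F = ∈∁⇒∉ {P = F} (∩⊆ʳ S (∁ F) s∈S∖F)
      rest : CommonNeighbourhood G m S (N G s ∩ W) (F ∪ ⁅ s ⁆) c
      rest = greedy-hubs m
        (≤-trans (+-monoˡ-≤ m (count-∪⁅⁆ F s)) (≤-trans (≤-reflexive (sym (+-suc (count F) m))) F+m≤B))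
        1≤c (dense ∘ ∩⊆ʳ (N G s) W)
        (*-cancelˡ-≤ K (begin
          K * (K ^ m * c)   ≡⟨ *-assoc K (K ^ m) c ⟨
          K ^ suc m * c     ≤⟨ K^m*c≤W ⟩
          count W           ≤⟨ proj₂ (proj₂ popular) ⟩
          K * degIn G W s   ∎))

    biclique : ∀ t {S W F : VSet n} {B : ℕ} → count F + t ≤ B →
               (∀ {w} → w ∈ W → n + K * B ≤ K * degIn G S w) → K ^ t * suc (t + B) ≤ count W →
               Biclique G t S W F
    biclique t {S} {W} {F} {B} F+t≤B dense W-large = record
      { vertices = hubs star ⊎-fresh proj₁ leaves
      ; left⊆S = hubs⊆S star
      ; right⊆W = λ j → common⊆W star (proj₂ leaves j)
      ; complete = λ i j → adjacent star (proj₂ leaves j) i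
      }
      where
      star = greedy-hubs t F+t≤B (s≤s z≤n) dense W-large
      leaves = choose t {common star} {used (hubs star)}
        (≤-trans (+-monoʳ-≤ t (≤-trans (∣used∣ (hubs star)) F+t≤B))
                 (≤-trans (n≤1+n (t + B)) (∣common∣ star)))

module ForbiddenSubgraphs where

  open Counting
  open Neighbourhoods
  open FreshInjections
  open GreedyEmbedding
  open import Defs hiding (sym)
  open import Data.Fin using (Fin)
  open import Data.Fin.Patterns using (0F; 1F; 2F; 3F)
  open import Data.Nat using (ℕ; suc; _+_; _*_; _^_; _≤_; _<_; z≤n; s≤s; _≤ᵇ_; _≤?_)
  open import Data.Nat.Properties hiding (_≟_)
  open import Data.Nat.Tactic.RingSolver using (solve-∀)
  open import Data.Product using (Σ; _×_; _,_)
  open import Data.Sum using (_⊎_; inj₁; inj₂)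
  open import Function using (_∘_)
  open import Relation.Binary.PropositionalEquality using (_≡_; _≢_; refl; cong; sym; subst)
  open import Relation.Nullary using (¬_)
  open import Relation.Nullary.Decidable using (decidable-stable)

  module _ {n : ℕ} (G : Graph n) where

    Triangle : Fin n → Fin n → Fin n → Set
    Triangle p q r = Adj G p q × Adj G q r × Adj G p r

    rich : Fin n → VSet n
    rich p w = n ≤ᵇ 1000 * degIn G (N G p) w

    rich⇒dense : ∀ {p w} → w ∈ rich p → n ≤ 1000 * degIn G (N G p) w
    rich⇒dense = ≤ᵇ⇒≤ n _

    ∉rich⇒sparse : ∀ {p w} → w ∉ rich p → 1000 * degIn G (N G p) w < n
    ∉rich⇒sparse w∉rich = ≰⇒> (w∉rich ∘ ≤⇒≤ᵇ)

    swap₁₂ : ∀ {p q r} → Triangle p q r → Triangle q p r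
    swap₁₂ (pq , qr , pr) = Defs.sym G pq , pr , qr

    swap₂₃ : ∀ {p q r} → Triangle p q r → Triangle p r q
    swap₂₃ (pq , qr , pr) = pr , Defs.sym G qr , pq

    Adj⇒≢ : ∀ {a b} → Adj G a b → a ≢ b
    Adj⇒≢ ab refl = irrefl G ab

    triangle-vertices : ∀ {p q r} → Triangle p q r → Fresh (Fin 3) 3 ∅
    triangle-vertices {p} {q} {r} (pq , qr , pr) =
      fresh-∷ p (λ ()) (fresh-∷ q q∉ (fresh-∷ r r∉ fresh-[]))
      where
      q∉ : q ∉ ∅ ∪ ⁅ p ⁆
      q∉ = ∉-∪ ∅ ⁅ p ⁆ {q} (λ ()) (∉⁅⁆ (Adj⇒≢ (Defs.sym G pq)))
      r∉ : r ∉ (∅ ∪ ⁅ p ⁆) ∪ ⁅ q ⁆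
      r∉ = ∉-∪ (∅ ∪ ⁅ p ⁆) ⁅ q ⁆ {r} (∉-∪ ∅ ⁅ p ⁆ {r} (λ ()) (∉⁅⁆ (Adj⇒≢ (Defs.sym G pr))))
                                     (∉⁅⁆ (Adj⇒≢ (Defs.sym G qr)))

    embeds : {V : Set} {m : ℕ} {F : VSet n} {E₀ : V → V → Set} (g : Fresh V m F) →
             (∀ {a b} → E₀ a b → Adj G (ι g a) (ι g b)) → Contains G V (λ a b → E₀ a b ⊎ E₀ b a)
    embeds g edge = ι g , ι-injective g , λ { (inj₁ e) → edge e ; (inj₂ e) → Defs.sym G (edge e) }

  module _ {t : ℕ} where

    HLayout : Set
    HLayout = (Fin 3 ⊎ (Fin t ⊎ Fin t)) ⊎ (Fin t ⊎ Fin t)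

    encodeH : HV t → HLayout
    encodeH x = inj₁ (inj₁ 0F)
    encodeH y = inj₁ (inj₁ 1F)
    encodeH z = inj₁ (inj₁ 2F)
    encodeH (a₁ i) = inj₁ (inj₂ (inj₁ i))
    encodeH (b₁ i) = inj₁ (inj₂ (inj₂ i))
    encodeH (b₂ i) = inj₂ (inj₁ i)
    encodeH (a₂ i) = inj₂ (inj₂ i)

    decodeH : HLayout → HV t
    decodeH (inj₁ (inj₁ 0F)) = x
    decodeH (inj₁ (inj₁ 1F)) = y
    decodeH (inj₁ (inj₁ 2F)) = z
    decodeH (inj₁ (inj₂ (inj₁ i))) = a₁ i
    decodeH (inj₁ (inj₂ (inj₂ i))) = b₁ i
    decodeH (inj₂ (inj₁ i)) = b₂ i
    decodeH (inj₂ (inj₂ i)) = a₂ i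

    decodeH∘encodeH : ∀ a → decodeH (encodeH a) ≡ a
    decodeH∘encodeH x = refl
    decodeH∘encodeH y = refl
    decodeH∘encodeH z = refl
    decodeH∘encodeH (a₁ i) = refl
    decodeH∘encodeH (b₁ i) = refl
    decodeH∘encodeH (b₂ i) = refl
    decodeH∘encodeH (a₂ i) = refl

    QLayout : Set
    QLayout = (((Fin 3 ⊎ Fin t) ⊎ Fin t) ⊎ Fin t) ⊎ Fin t

    encodeQ : QV t → QLayout
    encodeQ (v j) = inj₁ (inj₁ (inj₁ (inj₁ j)))
    encodeQ (u 0F i) = inj₁ (inj₁ (inj₁ (inj₂ i)))
    encodeQ (u 1F i) = inj₁ (inj₁ (inj₂ i))
    encodeQ (u 2F i) = inj₁ (inj₂ i)
    encodeQ (u 3F i) = inj₂ i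

    decodeQ : QLayout → QV t
    decodeQ (inj₁ (inj₁ (inj₁ (inj₁ j)))) = v j
    decodeQ (inj₁ (inj₁ (inj₁ (inj₂ i)))) = u 0F i
    decodeQ (inj₁ (inj₁ (inj₂ i))) = u 1F i
    decodeQ (inj₁ (inj₂ i)) = u 2F i
    decodeQ (inj₂ i) = u 3F i

    decodeQ∘encodeQ : ∀ a → decodeQ (encodeQ a) ≡ a
    decodeQ∘encodeQ (v j) = refl
    decodeQ∘encodeQ (u 0F i) = refl
    decodeQ∘encodeQ (u 1F i) = refl
    decodeQ∘encodeQ (u 2F i) = refl
    decodeQ∘encodeQ (u 3F i) = refl

  module _ {n : ℕ} (G : Graph n) where

    H-from-bicliques : ∀ {t p q r} (pqr : Triangle G p q r) →
      (B₁ : Biclique G t (N G p) (N G q ∩ rich G p) (used (triangle-vertices G pqr))) →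
      Biclique G t all (N G r) (used (vertices B₁)) → Contains G (HV t) (HE t)
    H-from-bicliques {t} {p} {q} {r} pqr@(pq , qr , pr) B₁ B₂ =
      embeds G (reindex encodeH (retraction⇒injective encodeH decodeH decodeH∘encodeH)
                        (triangle-vertices G pqr ⊎-fresh vertices B₁ ⊎-fresh vertices B₂)) edge
      where
      edge : ∀ {a b} → HE₀ t a b → Adj G _ _
      edge (a₁b₁ i j) = Defs.sym G (complete B₁ i j)
      edge (a₂b₂ i j) = complete B₂ j i
      edge xy = pq
      edge yz = qr
      edge xz = pr
      edge (xa₁ i) = ∈N⇒Adj G (left⊆S B₁ i)
      edge (yb₁ j) = ∈N⇒Adj G (∩⊆ˡ (N G q) (rich G p) (right⊆W B₁ j))
      edge (za₂ j) = ∈N⇒Adj G (right⊆W B₂ j)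

    Q-from-hubs : ∀ {t p q r W c₁ c₂ c₃} (pqr : Triangle G p q r) →
      (C₁ : CommonNeighbourhood G t (N G p) W (used (triangle-vertices G pqr)) c₁) →
      (C₂ : CommonNeighbourhood G t (N G q) (common C₁) (used (hubs C₁)) c₂) →
      (C₃ : CommonNeighbourhood G t (N G r) (common C₂) (used (hubs C₂)) c₃) →
      Σ (Fresh (Fin t) t (used (hubs C₃))) (λ g → ∀ i → ι g i ∈ common C₃) →
      Contains G (QV t) (QE t)
    Q-from-hubs {t} pqr@(pq , qr , pr) C₁ C₂ C₃ (leaves , leaves⊆common) =
      embeds G (reindex encodeQ (retraction⇒injective encodeQ decodeQ decodeQ∘encodeQ)
                        (triangle-vertices G pqr ⊎-fresh hubs C₁ ⊎-fresh hubs C₂ ⊎-fresh hubs C₃ ⊎-fresh leaves)) edge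
      where
      edge : ∀ {a b} → QE₀ t a b → Adj G _ _
      edge (vv {0F} {1F} _) = pq
      edge (vv {0F} {2F} _) = pr
      edge (vv {1F} {2F} _) = qr
      edge (vv {0F} {0F} ())
      edge (vv {1F} {0F} ())
      edge (vv {1F} {1F} (s≤s ()))
      edge (vv {2F} {0F} ())
      edge (vv {2F} {1F} (s≤s ()))
      edge (vv {2F} {2F} (s≤s (s≤s ())))
      edge (vU 0F i) = ∈N⇒Adj G (hubs⊆S C₁ i)
      edge (vU 1F i) = ∈N⇒Adj G (hubs⊆S C₂ i)
      edge (vU 2F i) = ∈N⇒Adj G (hubs⊆S C₃ i)
      edge (U₄U 0F i k) = adjacent C₁ (common⊆W C₂ (common⊆W C₃ (leaves⊆common k))) i
      edge (U₄U 1F i k) = adjacent C₂ (common⊆W C₃ (leaves⊆common k)) i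
      edge (U₄U 2F i k) = adjacent C₃ (leaves⊆common k) i

  -- Every greedy step of the two embeddings avoids at most budget t = 3 + 3t vertices; with
  -- K = 2 · 1000 a vertex with n/1000 neighbours in S keeps n/K of them outside those, and
  -- n₀ t makes n/1000 vertices enough for three rounds of t hubs (M t).
  K : ℕ
  K = 2000

  budget : ℕ → ℕ
  budget t = 3 + t + t + t

  M : ℕ → ℕ
  M t = K ^ t * (K ^ t * (K ^ t * suc (t + budget t)))

  n₀ : ℕ → ℕ
  n₀ t = 1000 * M t + K * budget t

  m≤K^t*m : ∀ t m → m ≤ K ^ t * m
  m≤K^t*m t m = m≤n*m m (K ^ t) {{m^n≢0 K t}}

  biclique-size≤M : ∀ t → K ^ t * suc (t + budget t) ≤ M t
  biclique-size≤M t = ≤-trans (m≤K^t*m t _) (m≤K^t*m t _)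

  3+t≤budget : ∀ t → 3 + t ≤ budget t
  3+t≤budget t = ≤-trans (m≤m+n (3 + t) t) (m≤m+n (3 + t + t) t)

  module _ {n : ℕ} (G : Graph n) {t : ℕ} (large : n₀ t ≤ n) where

    dense⇒greedy : ∀ d → n ≤ 1000 * d → n + K * budget t ≤ K * d
    dense⇒greedy d n≤1000d = begin
      n + K * budget t      ≤⟨ +-monoʳ-≤ n (m≤n+m (K * budget t) (1000 * M t)) ⟩
      n + n₀ t              ≤⟨ +-monoʳ-≤ n large ⟩
      n + n                 ≤⟨ +-mono-≤ n≤1000d n≤1000d ⟩
      1000 * d + 1000 * d   ≡⟨ double d ⟩
      K * d                 ∎
      where
      open ≤-Reasoning
      double : ∀ d → 1000 * d + 1000 * d ≡ 2000 * d
      double = solve-∀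

    rich⇒greedy : ∀ s {w} → w ∈ rich G s → n + K * budget t ≤ K * degIn G (N G s) w
    rich⇒greedy s {w} w∈ = dense⇒greedy (degIn G (N G s) w) (rich⇒dense G w∈)

    M≤count : (W : VSet n) → n ≤ 1000 * count W → M t ≤ count W
    M≤count W n≤1000W =
      *-cancelˡ-≤ 1000 (≤-trans (m≤m+n (1000 * M t) (K * budget t)) (≤-trans large n≤1000W))

    triangle-used : ∀ {p q r} (pqr : Triangle G p q r) → count (used (triangle-vertices G pqr)) ≤ 3
    triangle-used pqr = ≤-trans (∣used∣ (triangle-vertices G pqr)) (≤-reflexive (cong (_+ 3) (count-∅ {n})))

    H-free⇒few-rich-neighbours : (∀ a → n ≤ 1000 * count (N G a)) → ¬ Contains G (HV t) (HE t) →
                                 ∀ {p q r} → Triangle G p q r → 1000 * count (N G q ∩ rich G p) ≤ n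
    H-free⇒few-rich-neighbours min-degree noH {p} {q} {r} pqr =
      decidable-stable (1000 * count W ≤? n) (λ many → noH (H-from-bicliques G pqr (B₁ many) (B₂ many)))
      where
      W = N G q ∩ rich G p
      B₁ : ¬ 1000 * count W ≤ n → Biclique G t (N G p) W (used (triangle-vertices G pqr))
      B₁ many = biclique G K t
        (≤-trans (+-monoˡ-≤ t (triangle-used pqr)) (3+t≤budget t))
        (rich⇒greedy p ∘ ∩⊆ʳ (N G q) (rich G p))
        (≤-trans (biclique-size≤M t) (M≤count W (<⇒≤ (≰⇒> many))))
      B₂ : (many : ¬ 1000 * count W ≤ n) → Biclique G t all (N G r) (used (vertices (B₁ many)))
      B₂ many = biclique G K t
        (≤-trans (+-monoˡ-≤ t (≤-trans (∣used∣ (vertices (B₁ many))) (+-monoˡ-≤ (t + t) (triangle-used pqr))))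
                 (≤-reflexive (cong (_+ t) (sym (+-assoc 3 t t)))))
        (λ {w} _ → dense⇒greedy (degIn G all w) (subst (λ d → n ≤ 1000 * d) (degIn-all G w) (min-degree w)))
        (≤-trans (biclique-size≤M t) (M≤count (N G r) (min-degree r)))

    Q-free⇒few-common-rich : ¬ Contains G (QV t) (QE t) →
                             ∀ {p q r} → Triangle G p q r → 1000 * count (rich G p ∩ rich G q ∩ rich G r) ≤ n
    Q-free⇒few-common-rich noQ {p} {q} {r} pqr =
      decidable-stable (1000 * count W ≤? n) (λ many → noQ (embedding many))
      where
      W = rich G p ∩ rich G q ∩ rich G r
      B = budget t
      c₃ = suc (t + B)
      c₂ = K ^ t * c₃
      c₁ = K ^ t * c₂
      positive : ∀ m → 1 ≤ m → 1 ≤ K ^ t * m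
      positive m 1≤m = ≤-trans 1≤m (m≤K^t*m t m)
      embedding : ¬ 1000 * count W ≤ n → Contains G (QV t) (QE t)
      embedding many = Q-from-hubs G pqr C₁ C₂ C₃ leaves
        where
        C₁ : CommonNeighbourhood G t (N G p) W (used (triangle-vertices G pqr)) c₁
        C₁ = greedy-hubs G K t
          (≤-trans (+-monoˡ-≤ t (triangle-used pqr)) (3+t≤budget t))
          (positive c₂ (positive c₃ (s≤s z≤n)))
          (rich⇒greedy p ∘ ∩⊆ˡ (rich G p) (rich G q ∩ rich G r))
          (M≤count W (<⇒≤ (≰⇒> many)))
        used₁ : count (used (hubs C₁)) ≤ 3 + t
        used₁ = ≤-trans (∣used∣ (hubs C₁)) (+-monoˡ-≤ t (triangle-used pqr))
        C₂ : CommonNeighbourhood G t (N G q) (common C₁) (used (hubs C₁)) c₂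
        C₂ = greedy-hubs G K t
          (≤-trans (+-monoˡ-≤ t used₁) (m≤m+n (3 + t + t) t))
          (positive c₃ (s≤s z≤n))
          (rich⇒greedy q ∘ ∩⊆ˡ (rich G q) (rich G r) ∘ ∩⊆ʳ (rich G p) (rich G q ∩ rich G r) ∘ common⊆W C₁)
          (∣common∣ C₁)
        used₂ : count (used (hubs C₂)) ≤ 3 + t + t
        used₂ = ≤-trans (∣used∣ (hubs C₂)) (+-monoˡ-≤ t used₁)
        C₃ : CommonNeighbourhood G t (N G r) (common C₂) (used (hubs C₂)) c₃
        C₃ = greedy-hubs G K t
          (+-monoˡ-≤ t used₂)
          (s≤s z≤n)
          (rich⇒greedy r ∘ ∩⊆ʳ (rich G q) (rich G r) ∘ ∩⊆ʳ (rich G p) (rich G q ∩ rich G r)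
                         ∘ common⊆W C₁ ∘ common⊆W C₂)
          (∣common∣ C₂)
        leaves = choose t {common C₃} {used (hubs C₃)}
          (≤-trans (+-monoʳ-≤ t (≤-trans (∣used∣ (hubs C₃)) (+-monoˡ-≤ t used₂)))
                   (≤-trans (n≤1+n (t + B)) (∣common∣ C₃)))

module DenseTriangles where

  open Counting
  open Neighbourhoods
  open ForbiddenSubgraphs using (Triangle; rich; rich⇒dense; ∉rich⇒sparse; swap₁₂; swap₂₃)
  open import Defs using (Graph; Adj)
  open import Data.Bool using (Bool; true; false; _∧_)
  open import Data.Fin using (Fin)
  open import Data.Fin.Properties using (nonZeroIndex)
  open import Data.List using (List; []; _∷_)
  open import Data.List.Relation.Unary.All using ([]; _∷_)
  open import Data.Nat using (ℕ; zero; suc; _+_; _*_; _≤_; z≤n; s≤s; _≤?_; NonZero; >-nonZero⁻¹)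
  open import Data.Nat.Properties hiding (_≟_)
  open import Data.Nat.Tactic.RingSolver using (solve-∀)
  open import Algebra.Properties.CommutativeSemigroup *-commutativeSemigroup using (x∙yz≈y∙xz)
  open import Data.Empty using (⊥; ⊥-elim)
  open import Data.Product using (_,_; proj₁; proj₂)
  open import Data.Unit using (tt)
  open import Relation.Binary.PropositionalEquality hiding ([_])
  open import Relation.Nullary using (Dec; yes; no)
  open import Relation.Nullary.Decidable using (from-yes)

  ∀-Bool? : {P : Bool → Set} → (∀ b → Dec (P b)) → Dec (∀ b → P b)
  ∀-Bool? P? with P? false | P? true
  ... | yes P-false | yes P-true = yes λ { false → P-false ; true → P-true }
  ... | no ¬P-false | _ = no λ P-all → ¬P-false (P-all false)
  ... | yes _ | no ¬P-true = no λ P-all → ¬P-true (P-all true)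

  -- At a vertex w, ax says whether w ∈ N(x) and rx whether w is rich for x.
  triangle-pattern : ∀ ap aq ar rp rq rr →
    #true (rp ∷ rq ∷ rr ∷ []) + 2 * #true (ap ∷ aq ∷ ar ∷ []) ≤
    2 + 2 * #true (ap ∧ aq ∷ ap ∧ ar ∷ aq ∧ ar ∷ []) + ⟦ rp ∧ rq ∧ rr ⟧
      + 3 * (#true (ap ∧ rp ∷ aq ∧ rq ∷ ar ∧ rr ∷ [])
             + #true (aq ∧ rp ∷ ar ∧ rp ∷ ap ∧ rq ∷ ar ∧ rq ∷ ap ∧ rr ∷ aq ∧ rr ∷ []))
  triangle-pattern = from-yes
    (∀-Bool? λ ap → ∀-Bool? λ aq → ∀-Bool? λ ar → ∀-Bool? λ rp → ∀-Bool? λ rq → ∀-Bool? λ rr →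
      #true (rp ∷ rq ∷ rr ∷ []) + 2 * #true (ap ∷ aq ∷ ar ∷ []) ≤?
      2 + 2 * #true (ap ∧ aq ∷ ap ∧ ar ∷ aq ∧ ar ∷ []) + ⟦ rp ∧ rq ∧ rr ⟧
        + 3 * (#true (ap ∧ rp ∷ aq ∧ rq ∷ ar ∧ rr ∷ [])
               + #true (aq ∧ rp ∷ ar ∧ rp ∷ ap ∧ rq ∷ ar ∧ rq ∷ ap ∧ rr ∷ aq ∧ rr ∷ [])))

  rich-arithmetic : ∀ n X r → X * (240 * n) ≤ r * (1000 * X) + n * n → 240 * n ≤ 1000 * X →
                    230 * n ≤ 1000 * r
  rich-arithmetic n zero r _ 240n≤0 = ≤-trans (*-monoˡ-≤ n (≤ᵇ⇒≤ 230 240 tt)) (≤-trans 240n≤0 z≤n)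
  rich-arithmetic n X@(suc _) r double-count 240n≤1000X =
    *-cancelˡ-≤ 240 (*-cancelʳ-≤ _ _ X (+-cancelʳ-≤ (1000 * n * X) _ _ (begin
      240 * (230 * n) * X + 1000 * n * X      ≡⟨ e₁ n X ⟩
      56200 * (n * X)                         ≤⟨ *-monoˡ-≤ (n * X) (≤ᵇ⇒≤ 56200 57600 tt) ⟩
      57600 * (n * X)                         ≡⟨ e₂ n X ⟩
      240 * (X * (240 * n))                   ≤⟨ *-monoʳ-≤ 240 double-count ⟩
      240 * (r * (1000 * X) + n * n)          ≡⟨ e₃ n X r ⟩
      240 * (1000 * r) * X + n * (240 * n)    ≤⟨ +-monoʳ-≤ (240 * (1000 * r) * X) (*-monoʳ-≤ n 240n≤1000X) ⟩
      240 * (1000 * r) * X + n * (1000 * X)   ≡⟨ e₄ n X r ⟩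
      240 * (1000 * r) * X + 1000 * n * X     ∎)))
    where
    open ≤-Reasoning
    e₁ : ∀ n X → 240 * (230 * n) * X + 1000 * n * X ≡ 56200 * (n * X)
    e₁ = solve-∀
    e₂ : ∀ n X → 57600 * (n * X) ≡ 240 * (X * (240 * n))
    e₂ = solve-∀
    e₃ : ∀ n X r → 240 * (r * (1000 * X) + n * n) ≡ 240 * (1000 * r) * X + n * (240 * n)
    e₃ = solve-∀
    e₄ : ∀ n X r → 240 * (1000 * r) * X + n * (1000 * X) ≡ 240 * (1000 * r) * X + 1000 * n * X
    e₄ = solve-∀

  triangle-arithmetic : ∀ n .{{_ : NonZero n}} R D Pa T Di Of →
    R + 2 * D ≤ n * 2 + 2 * Pa + T + 3 * (Di + Of) →
    3 * (230 * n) ≤ 1000 * R → 3 * (240 * n) ≤ 1000 * D →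
    1000 * Pa ≤ 3 * (5 * n) → 1000 * T ≤ n → 1000 * Di ≤ 3 * (5 * n) → 1000 * Of ≤ 6 * n → ⊥
  triangle-arithmetic n R D Pa T Di Of counting R-large D-large Pa-small T-small Di-small Of-small =
    <⇒≱ (*-monoˡ-< n (≤ᵇ⇒≤ 2095 2130 tt)) (begin
      2130 * n                                                              ≡⟨ e₁ n ⟩
      3 * (230 * n) + 2 * (3 * (240 * n))                                   ≤⟨ +-mono-≤ R-large (*-monoʳ-≤ 2 D-large) ⟩
      1000 * R + 2 * (1000 * D)                                             ≡⟨ e₂ R D ⟩
      1000 * (R + 2 * D)                                                    ≤⟨ *-monoʳ-≤ 1000 counting ⟩
      1000 * (n * 2 + 2 * Pa + T + 3 * (Di + Of))                           ≡⟨ e₃ n Pa T Di Of ⟩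
      2000 * n + 2 * (1000 * Pa) + 1000 * T + 3 * (1000 * Di + 1000 * Of)
        ≤⟨ +-mono-≤ (+-mono-≤ (+-monoʳ-≤ (2000 * n) (*-monoʳ-≤ 2 Pa-small)) T-small)
                    (*-monoʳ-≤ 3 (+-mono-≤ Di-small Of-small)) ⟩
      2000 * n + 2 * (3 * (5 * n)) + n + 3 * (3 * (5 * n) + 6 * n)          ≡⟨ e₄ n ⟩
      2094 * n                                                              ∎)
    where
    open ≤-Reasoning
    e₁ : ∀ n → 2130 * n ≡ 3 * (230 * n) + 2 * (3 * (240 * n))
    e₁ = solve-∀
    e₂ : ∀ R D → 1000 * R + 2 * (1000 * D) ≡ 1000 * (R + 2 * D)
    e₂ = solve-∀
    e₃ : ∀ n Pa T Di Of → 1000 * (n * 2 + 2 * Pa + T + 3 * (Di + Of)) ≡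
                          2000 * n + 2 * (1000 * Pa) + 1000 * T + 3 * (1000 * Di + 1000 * Of)
    e₃ = solve-∀
    e₄ : ∀ n → 2000 * n + 2 * (3 * (5 * n)) + n + 3 * (3 * (5 * n) + 6 * n) ≡ 2094 * n
    e₄ = solve-∀

  module _ {n : ℕ} (G : Graph n)
    (min-degree : ∀ a → 240 * n ≤ 1000 * count (N G a))
    (few-rich-neighbours : ∀ {p q r} → Triangle G p q r → 1000 * count (N G q ∩ rich G p) ≤ n)
    where

    N△ : Fin n → VSet n
    N△ p = N G p ∩ touches G (N G p)

    rich-large : ∀ p → 230 * n ≤ 1000 * count (rich G p)
    rich-large p = rich-arithmetic n (count (N G p)) (count R) double-count (min-degree p)
      where
      open ≤-Reasoning
      R = rich G p
      f = degIn G (N G p)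
      rich-part : 1000 * ∑[ w ∈ R ] f w ≤ count R * (1000 * count (N G p))
      rich-part = ∑∈-≤ R 1000 λ {w} _ → *-monoʳ-≤ 1000 (count-mono {P = N G w ∩ N G p} (∩⊆ʳ (N G w) (N G p)))
      poor-part : 1000 * ∑[ w ∈ ∁ R ] f w ≤ n * n
      poor-part = ≤-trans (∑∈-≤ (∁ R) 1000 (λ {w} w∈∁R → <⇒≤ (∉rich⇒sparse G {p} {w} (∈∁⇒∉ {P = R} w∈∁R))))
                          (*-monoˡ-≤ n (count≤n (∁ R)))
      double-count : count (N G p) * (240 * n) ≤ count R * (1000 * count (N G p)) + n * n
      double-count = begin
        count (N G p) * (240 * n)
          ≤⟨ ∑∈-≥ (N G p) 1000 (λ {a} _ → subst (λ d → 240 * n ≤ 1000 * d) (degIn-all G a) (min-degree a)) ⟩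
        1000 * ∑[ a ∈ N G p ] degIn G all a              ≡⟨ cong (1000 *_) (double-counting G (N G p) all) ⟩
        1000 * ∑[ w < n ] f w                            ≡⟨ cong (1000 *_) (∑-partition R f) ⟩
        1000 * (∑[ w ∈ R ] f w + ∑[ w ∈ ∁ R ] f w)       ≡⟨ *-distribˡ-+ 1000 (∑[ w ∈ R ] f w) _ ⟩
        1000 * ∑[ w ∈ R ] f w + 1000 * ∑[ w ∈ ∁ R ] f w  ≤⟨ +-mono-≤ rich-part poor-part ⟩
        count R * (1000 * count (N G p)) + n * n         ∎

    N△-small : ∀ p → 239 * count (N△ p) ≤ n
    N△-small p = *-cancelʳ-≤ (239 * count A) n n {{nonZeroIndex p}} (begin
      239 * count A * n                       ≡⟨ *-assoc 239 (count A) n ⟩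
      239 * (count A * n)                     ≡⟨ x∙yz≈y∙xz 239 (count A) n ⟩
      count A * (239 * n)                     ≤⟨ ∑∈-≥ A 1000 many-poor-neighbours ⟩
      1000 * ∑[ a ∈ A ] degIn G (∁ R) a       ≡⟨ cong (1000 *_) (double-counting G A (∁ R)) ⟩
      1000 * ∑[ w ∈ ∁ R ] degIn G A w         ≤⟨ ∑∈-≤ (∁ R) 1000 few-neighbours-in-A ⟩
      count (∁ R) * n                         ≤⟨ *-monoˡ-≤ n (count≤n (∁ R)) ⟩
      n * n                                   ∎)
      where
      open ≤-Reasoning
      A = N△ p
      R = rich G p
      many-poor-neighbours : ∀ {a} → a ∈ A → 239 * n ≤ 1000 * degIn G (∁ R) a
      many-poor-neighbours {a} a∈A = +-cancelʳ-≤ n (239 * n) (1000 * degIn G (∁ R) a) (begin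
        239 * n + n                                         ≡⟨ +-comm (239 * n) n ⟩
        240 * n                                             ≤⟨ min-degree a ⟩
        1000 * count (N G a)                                ≡⟨ cong (1000 *_) (count-split (N G a) R) ⟩
        1000 * (count (N G a ∩ R) + degIn G (∁ R) a)        ≡⟨ *-distribˡ-+ 1000 (count (N G a ∩ R)) (degIn G (∁ R) a) ⟩
        1000 * count (N G a ∩ R) + 1000 * degIn G (∁ R) a
          ≤⟨ +-monoˡ-≤ (1000 * degIn G (∁ R) a) (few-rich-neighbours pab) ⟩
        n + 1000 * degIn G (∁ R) a                          ≡⟨ +-comm n (1000 * degIn G (∁ R) a) ⟩
        1000 * degIn G (∁ R) a + n                          ∎)
        where
        common-neighbour = count-pos⇒∈ (N G a ∩ N G p) (≤ᵇ⇒≤ 1 _ (∩⊆ʳ (N G p) (touches G (N G p)) a∈A))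
        b = proj₁ common-neighbour
        b∈Na∩Np = proj₂ common-neighbour
        pab : Triangle G p a b
        pab = ∈N⇒Adj G (∩⊆ˡ (N G p) (touches G (N G p)) a∈A)
            , ∈N⇒Adj G (∩⊆ˡ (N G a) (N G p) b∈Na∩Np)
            , ∈N⇒Adj G (∩⊆ʳ (N G a) (N G p) b∈Na∩Np)
      few-neighbours-in-A : ∀ {w} → w ∈ ∁ R → 1000 * degIn G A w ≤ n
      few-neighbours-in-A {w} w∈∁R = <⇒≤ (≤-<-trans (*-monoʳ-≤ 1000 (count-mono {P = N G w ∩ A} Nw∩A⊆Nw∩Np))
                                                    (∉rich⇒sparse G {p} {w} (∈∁⇒∉ {P = R} w∈∁R)))
        where
        Nw∩A⊆Nw∩Np : N G w ∩ A ⊆ N G w ∩ N G p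
        Nw∩A⊆Nw∩Np h = ∩⁺ (N G w) (N G p) (∩⊆ˡ (N G w) A h) (∩⊆ˡ (N G p) (touches G (N G p)) (∩⊆ʳ (N G w) A h))

    common-neighbours⊆N△ : ∀ {p q} → Adj G p q → N G p ∩ N G q ⊆ N△ p
    common-neighbours⊆N△ {p} {q} pq {w} w∈NpNq =
      ∩⁺ (N G p) (touches G (N G p)) (∩⊆ˡ (N G p) (N G q) w∈NpNq)
         (≤⇒≤ᵇ (∈⇒count-pos {P = N G w ∩ N G p}
                 (∩⁺ (N G w) (N G p) (∈N-sym G (∩⊆ʳ (N G p) (N G q) w∈NpNq)) (Adj⇒∈N G pq))))

    rich-neighbours⊆N△ : ∀ p → N G p ∩ rich G p ⊆ N△ p
    rich-neighbours⊆N△ p {w} w∈Np∩Rp =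
      ∩⁺ (N G p) (touches G (N G p)) (∩⊆ˡ (N G p) (rich G p) w∈Np∩Rp)
         (≤⇒≤ᵇ (positive-factor (degIn G (N G p) w) (rich⇒dense G (∩⊆ʳ (N G p) (rich G p) w∈Np∩Rp))))
      where
      positive-factor : ∀ d → n ≤ 1000 * d → 1 ≤ d
      positive-factor zero n≤0 = ⊥-elim (<⇒≱ (>-nonZero⁻¹ n {{nonZeroIndex p}}) n≤0)
      positive-factor (suc d) _ = s≤s z≤n

    ⊆N△-small : ∀ p (P : VSet n) → P ⊆ N△ p → 1000 * count P ≤ 5 * n
    ⊆N△-small p P P⊆N△ = begin
      1000 * count P          ≤⟨ *-monoʳ-≤ 1000 (count-mono {P = P} P⊆N△) ⟩
      1000 * count (N△ p)     ≡⟨ *-assoc 5 200 (count (N△ p)) ⟩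
      5 * (200 * count (N△ p))  ≤⟨ *-monoʳ-≤ 5 (*-monoˡ-≤ (count (N△ p)) (≤ᵇ⇒≤ 200 239 tt)) ⟩
      5 * (239 * count (N△ p))  ≤⟨ *-monoʳ-≤ 5 (N△-small p) ⟩
      5 * n                   ∎
      where open ≤-Reasoning

    no-triangle : (∀ {p q r} → Triangle G p q r → 1000 * count (rich G p ∩ rich G q ∩ rich G r) ≤ n) →
                  ∀ {p q r} → Triangle G p q r → ⊥
    no-triangle few-common-rich {p} {q} {r} pqr@(pq , qr , pr) =
      triangle-arithmetic n {{nonZeroIndex p}}
        (counts Rs) (counts Ns) (counts Pairs) (count Triple) (counts Diag) (counts Off)
        counting-inequality
        (counts-≥ Rs 1000 (230 * n) (rich-large p ∷ rich-large q ∷ rich-large r ∷ []))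
        (counts-≥ Ns 1000 (240 * n) (min-degree p ∷ min-degree q ∷ min-degree r ∷ []))
        (counts-≤ Pairs 1000 (5 * n) ( ⊆N△-small p (N G p ∩ N G q) (common-neighbours⊆N△ pq)
                               ∷ ⊆N△-small p (N G p ∩ N G r) (common-neighbours⊆N△ pr)
                               ∷ ⊆N△-small q (N G q ∩ N G r) (common-neighbours⊆N△ qr) ∷ []))
        (few-common-rich pqr)
        (counts-≤ Diag 1000 (5 * n) ( ⊆N△-small p (N G p ∩ rich G p) (rich-neighbours⊆N△ p)
                               ∷ ⊆N△-small q (N G q ∩ rich G q) (rich-neighbours⊆N△ q)
                               ∷ ⊆N△-small r (N G r ∩ rich G r) (rich-neighbours⊆N△ r) ∷ []))
        (counts-≤ Off 1000 n ( few-rich-neighbours pqr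
                             ∷ few-rich-neighbours (swap₂₃ G pqr)
                             ∷ few-rich-neighbours (swap₁₂ G pqr)
                             ∷ few-rich-neighbours (swap₂₃ G (swap₁₂ G pqr))
                             ∷ few-rich-neighbours (swap₁₂ G (swap₂₃ G pqr))
                         ∷ few-rich-neighbours (swap₂₃ G (swap₁₂ G (swap₂₃ G pqr))) ∷ []))
      where
      Rs Ns Pairs Diag Off : List (VSet n)
      Rs = rich G p ∷ rich G q ∷ rich G r ∷ []
      Ns = N G p ∷ N G q ∷ N G r ∷ []
      Pairs = N G p ∩ N G q ∷ N G p ∩ N G r ∷ N G q ∩ N G r ∷ []
      Diag = N G p ∩ rich G p ∷ N G q ∩ rich G q ∷ N G r ∩ rich G r ∷ []
      Off = N G q ∩ rich G p ∷ N G r ∩ rich G p ∷ N G p ∩ rich G q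
          ∷ N G r ∩ rich G q ∷ N G p ∩ rich G r ∷ N G q ∩ rich G r ∷ []
      Triple : VSet n
      Triple = rich G p ∩ rich G q ∩ rich G r
      pointwise : ∀ w → hits Rs w + 2 * hits Ns w ≤
                        2 + 2 * hits Pairs w + ⟦ Triple w ⟧ + 3 * (hits Diag w + hits Off w)
      pointwise w = triangle-pattern (N G p w) (N G q w) (N G r w) (rich G p w) (rich G q w) (rich G r w)
      counting-inequality : counts Rs + 2 * counts Ns ≤
                            n * 2 + 2 * counts Pairs + count Triple + 3 * (counts Diag + counts Off)
      counting-inequality = begin
        counts Rs + 2 * counts Ns
          ≡⟨ cong₂ (λ a b → a + 2 * b) (∑-hits Rs) (∑-hits Ns) ⟨
        sum (hits Rs) + 2 * sum (hits Ns)
          ≡⟨ ∑-+-* (hits Rs) 2 (hits Ns) ⟨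
        ∑[ w < n ] (hits Rs w + 2 * hits Ns w)
          ≤⟨ ∑-mono pointwise ⟩
        ∑[ w < n ] (2 + 2 * hits Pairs w + ⟦ Triple w ⟧ + 3 * (hits Diag w + hits Off w))
          ≡⟨ ∑-+-* (λ w → 2 + 2 * hits Pairs w + ⟦ Triple w ⟧) 3 (λ w → hits Diag w + hits Off w) ⟩
        ∑[ w < n ] (2 + 2 * hits Pairs w + ⟦ Triple w ⟧) + 3 * ∑[ w < n ] (hits Diag w + hits Off w)
          ≡⟨ cong₂ (λ a b → a + 3 * b) (∑-distrib-+ (λ w → 2 + 2 * hits Pairs w) (λ w → ⟦ Triple w ⟧))
                                        (∑-distrib-+ (hits Diag) (hits Off)) ⟩
        ∑[ w < n ] (2 + 2 * hits Pairs w) + count Triple + 3 * (sum (hits Diag) + sum (hits Off))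
          ≡⟨ cong (λ a → a + count Triple + 3 * (sum (hits Diag) + sum (hits Off)))
                  (∑-+-* (λ _ → 2) 2 (hits Pairs)) ⟩
        ∑[ w < n ] 2 + 2 * sum (hits Pairs) + count Triple + 3 * (sum (hits Diag) + sum (hits Off))
          ≡⟨ cong₂ (λ a b → a + 2 * b + count Triple + 3 * (sum (hits Diag) + sum (hits Off)))
                   (∑-const n 2) (∑-hits Pairs) ⟩
        n * 2 + 2 * counts Pairs + count Triple + 3 * (sum (hits Diag) + sum (hits Off))
          ≡⟨ cong₂ (λ a b → n * 2 + 2 * counts Pairs + count Triple + 3 * (a + b))
                   (∑-hits Diag) (∑-hits Off) ⟩
        n * 2 + 2 * counts Pairs + count Triple + 3 * (counts Diag + counts Off)
          ∎
        where open ≤-Reasoning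

open Counting using (count)
open Neighbourhoods using (N; degree≡count)
open ForbiddenSubgraphs using (n₀; H-free⇒few-rich-neighbours; Q-free⇒few-common-rich)
open DenseTriangles using (no-triangle)
open import Defs
open import Data.Nat using (ℕ; _≥_)
open import Data.Fin using (Fin)
open import Data.Product using (Σ; ∃-syntax; _×_)
open import Data.Rational using (ℚ; _<_; _≤_; _*_; _/_)
open import Relation.Nullary using (¬_)
open import Data.Integer using (+_)

import Data.Nat as ℕ
import Data.Nat.Properties as ℕ
import Data.Integer as ℤ
import Data.Integer.Properties as ℤ
import Data.Rational as ℚ
import Data.Rational.Properties as ℚ
import Data.Rational.Unnormalised as ℚᵘ
import Data.Rational.Unnormalised.Properties as ℚᵘ
open import Data.Fin.Properties using (any?)
open import Data.Nat.Coprimality using (1-coprimeTo) renaming (sym to coprime-sym)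
open import Data.Product using (∃; _,_)
open import Relation.Binary.PropositionalEquality using (_≡_; cong; subst₂; trans) renaming (sym to ≡-sym)
open import Relation.Nullary.Decidable using (decidable-stable; from-yes)

module _ {n : ℕ} (G : Graph n) (high-degree : ∀ a → 6 ℕ.* n ℕ.< 25 ℕ.* degree G a) where

  minimum-degree : ∀ a → 240 ℕ.* n ℕ.≤ 1000 ℕ.* count (N G a)
  minimum-degree a = begin
    240 ℕ.* n              ≡⟨ ℕ.*-assoc 40 6 n ⟩
    40 ℕ.* (6 ℕ.* n)       ≤⟨ ℕ.*-monoʳ-≤ 40 (ℕ.<⇒≤ (high-degree a)) ⟩
    40 ℕ.* (25 ℕ.* degree G a)  ≡⟨ ℕ.*-assoc 40 25 (degree G a) ⟨
    1000 ℕ.* degree G a    ≡⟨ cong (1000 ℕ.*_) (degree≡count G a) ⟩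
    1000 ℕ.* count (N G a) ∎
    where open ℕ.≤-Reasoning

  rich-threshold : ∀ a → n ℕ.≤ 1000 ℕ.* count (N G a)
  rich-threshold a = ℕ.≤-trans (ℕ.m≤n*m n 240) (minimum-degree a)

low-degree-vertex : ∀ t {n} → n₀ t ℕ.≤ n → (G : Graph n) → HasTriangle G →
                    ¬ Contains G (HV t) (HE t) → ¬ Contains G (QV t) (QE t) →
                    ∃ λ w → 25 ℕ.* degree G w ℕ.≤ 6 ℕ.* n
low-degree-vertex t {n} large G (p , q , r , pqr) noH noQ =
  decidable-stable (any? λ w → 25 ℕ.* degree G w ℕ.≤? 6 ℕ.* n) λ none →
    let high-degree a = ℕ.≰⇒> (λ small → none (a , small)) in
    no-triangle G (minimum-degree G high-degree)
                (H-free⇒few-rich-neighbours G {t} large (rich-threshold G high-degree) noH)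
                (Q-free⇒few-common-rich G {t} large noQ) pqr

+m/1≡ : ∀ m → + m / 1 ≡ ℚ.mkℚ (+ m) 0 (coprime-sym (1-coprimeTo m))
+m/1≡ m = ℚ.normalize-coprime (coprime-sym (1-coprimeTo m))

fraction-bound : ∀ d m → 25 ℕ.* d ℕ.≤ 6 ℕ.* m → + d / 1 ≤ (+ 6 / 25) * (+ m / 1)
fraction-bound d m 25d≤6m rewrite +m/1≡ d | +m/1≡ m =
  ℚ.toℚᵘ-cancel-≤ (ℚᵘ.≤-respʳ-≃ (ℚᵘ.≃-sym (ℚ.toℚᵘ-homo-* (+ 6 / 25) (ℚ.mkℚ (+ m) 0 (coprime-sym (1-coprimeTo m)))))
                                (ℚᵘ.*≤* cross-multiplied))
  where
  cross-multiplied : + d ℤ.* + 25 ℤ.≤ + 6 ℤ.* + m ℤ.* + 1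
  cross-multiplied = subst₂ ℤ._≤_ (ℤ.pos-* d 25)
                                 (trans (ℤ.pos-* (6 ℕ.* m) 1) (cong (ℤ._* + 1) (ℤ.pos-* 6 m)))
    (ℤ.+≤+ (subst₂ ℕ._≤_ (ℕ.*-comm 25 d) (≡-sym (ℕ.*-identityʳ (6 ℕ.* m))) 25d≤6m))

proposition2p2 : (t : ℕ) → t ≥ 1 →
    ∃[ c ] (c < + 1 / 4 ×
      ∃[ n₀ ] (∀ n → n ≥ n₀ → (G : Graph n) → HasTriangle G →
        ¬ Contains G (HV t) (HE t) → ¬ Contains G (QV t) (QE t) →
        ∃[ w ] ((+ degree G w / 1) ≤ c * (+ n / 1))))
-- The argument works for every t.
proposition2p2 t _ = + 6 / 25 , from-yes (+ 6 / 25 ℚ.<? + 1 / 4) , n₀ t , λ n large G triangle noH noQ →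
  let w , small = low-degree-vertex t large G triangle noH noQ in w , fraction-bound (degree G w) n small
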